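{- Let $G$ be a connected chordal graph, $K^\star$ a maximal clique of $G$, and consider the layer structure of $C(G)$ rooted by $K^\star$. Let $U_1U_2$ and $U_3U_4$ be two distinct edges of the layer structure having the same label $S$. Then the units in $\{U_1,U_2,U_3,U_4\}$ are pairwise adjacent in the layer structure, and all edges among them have label $S$.
   Context: Graphs are finite, simple, undirected; chordal means no induced cycle of length greater than three. A $u$-$v$ separator of $G$ is a set $X\subseteq V(G)$ with $u,v$ in different components of $G-X$; it is minimal if no proper subset is one. The clique graph $C(G)$ has as nodes the maximal cliques of $G$; distinct nodes $K,K'$ are adjacent iff $K\cap K'$ is a minimal $u$-$v$ separator of $G$ for all $u\in K\setminus K'$, $v\in K'\setminus K$; edge $KK'$ has label $K\cap K'$ and weight $|K\cap K'|$. Units are the connected components of $C(G)$ after deleting all edges of minimum weight. An edge of $C(G)$ crosses units $U,U'$ if its endpoints lie one in each. The layer structure of $C(G)$ rooted by $K^\star$ is the graph whose vertices are the units, with $U,U'$ adjacent iff some edge of $C(G)$ crosses them; the label of edge $UU'$ is $K\cap K'$ for any edge $KK'$ of $C(G)$ crossing $U,U'$ (all such edges have the same label). The root is the unit containing $K^\star$. (The sets $\{U_1,U_2\}$ and $\{U_3,U_4\}$ may intersect.) -}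

module Defs where

open import Data.Nat using (ℕ; zero; suc; _<_; _≤_; _+_)
open import Data.Bool using (Bool; true; false)
open import Data.Fin using (Fin; toℕ)
open import Data.Fin.Subset using (Subset; _∈_; _∉_; _⊂_; _∩_; ∣_∣)
import Data.Fin.Subset as S
open import Data.Product using (Σ; ∃; _×_; _,_)
open import Data.Sum using (_⊎_)
open import Relation.Nullary using (¬_)
open import Relation.Binary.PropositionalEquality using (_≡_; _≢_)
open import Function.Bundles using (_⇔_)

record Graph (n : ℕ) : Set where
  field
    adj     : Fin n → Fin n → Bool
    sym     : ∀ u v → adj u v ≡ adj v u
    irrefl  : ∀ u → adj u u ≡ false

open Graph public

Adj : ∀ {n} → Graph n → Fin n → Fin n → Set
Adj G u v = adj G u v ≡ true

data Reach {n} (G : Graph n) (X : Subset n) (u : Fin n) : Fin n → Set where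
  here : u ∉ X → Reach G X u u
  step : ∀ {w v} → Reach G X u w → Adj G w v → v ∉ X → Reach G X u v

Connected : ∀ {n} → Graph n → Set
Connected {n} G = ∀ (u v : Fin n) → Reach G S.⊥ u v

CycConsec : ∀ {k} → Fin k → Fin k → Set
CycConsec {k} i j =
  (toℕ j ≡ suc (toℕ i)) ⊎ (toℕ i ≡ suc (toℕ j))
  ⊎ ((toℕ i ≡ 0 × suc (toℕ j) ≡ k) ⊎ (toℕ j ≡ 0 × suc (toℕ i) ≡ k))

InducedCycle : ∀ {n} → Graph n → (k : ℕ) → (Fin k → Fin n) → Set
InducedCycle G k c =
  (∀ i j → c i ≡ c j → i ≡ j) × (∀ i j → Adj G (c i) (c j) ⇔ CycConsec i j)

Chordal : ∀ {n} → Graph n → Set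
Chordal {n} G = ∀ (k : ℕ) → 3 < k → (c : Fin k → Fin n) → ¬ InducedCycle G k c

Separator : ∀ {n} → Graph n → Subset n → Fin n → Fin n → Set
Separator G X u v = u ∉ X × v ∉ X × ¬ Reach G X u v

MinimalSeparator : ∀ {n} → Graph n → Subset n → Fin n → Fin n → Set
MinimalSeparator {n} G X u v =
  Separator G X u v × (∀ (Y : Subset n) → Y ⊂ X → ¬ Separator G Y u v)

Clique : ∀ {n} → Graph n → Subset n → Set
Clique G K = ∀ u v → u ∈ K → v ∈ K → u ≢ v → Adj G u v

MaximalClique : ∀ {n} → Graph n → Subset n → Set
MaximalClique {n} G K =
  Clique G K × (∀ (K' : Subset n) → Clique G K' → K S.⊆ K' → K' ≡ K)

-- Clique graph C(G): nodes are maximal cliques; edge label K ∩ K',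
-- weight ∣ K ∩ K' ∣.

CEdge : ∀ {n} → Graph n → Subset n → Subset n → Set
CEdge G K K' =
  MaximalClique G K × MaximalClique G K' × K ≢ K'
  × (∀ u v → u ∈ K → u ∉ K' → v ∈ K' → v ∉ K → MinimalSeparator G (K ∩ K') u v)

-- an edge that survives deletion of all minimum-weight edges
HeavyEdge : ∀ {n} → Graph n → Subset n → Subset n → Set
HeavyEdge {n} G K K' =
  CEdge G K K' × Σ (Subset n) λ L → Σ (Subset n) λ L' →
    CEdge G L L' × ∣ L ∩ L' ∣ < ∣ K ∩ K' ∣

data SameUnit {n} (G : Graph n) (K : Subset n) : Subset n → Set where
  here : MaximalClique G K → SameUnit G K K
  step : ∀ {L M} → SameUnit G K L → (HeavyEdge G L M ⊎ HeavyEdge G M L) → SameUnit G K M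

-- Layer structure. A unit is represented by any maximal clique in it;
-- units U, U' are equal iff SameUnit G U U'.

Crossing : ∀ {n} → Graph n → Subset n → Subset n → Subset n → Subset n → Set
Crossing G U U' K K' = CEdge G K K' × SameUnit G U K × SameUnit G U' K'

LayerAdj : ∀ {n} → Graph n → Subset n → Subset n → Set
LayerAdj {n} G U U' =
  ¬ SameUnit G U U' × Σ (Subset n) λ K → Σ (Subset n) λ K' → Crossing G U U' K K'

LayerEdgeLabel : ∀ {n} → Graph n → Subset n → Subset n → Subset n → Set
LayerEdgeLabel {n} G U U' S =
  ¬ SameUnit G U U' × Σ (Subset n) λ K → Σ (Subset n) λ K' →
    Crossing G U U' K K' × K ∩ K' ≡ S

-- Layer structure of C(G) rooted by K⋆ (the root is the unit of K⋆);
-- the root does not affect the graph structure.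
LayerStructureRoot : ∀ {n} → Graph n → Subset n → Set
LayerStructureRoot G K⋆ = MaximalClique G K⋆

-- Let K₁K₂ be an edge of C(G) crossing two distinct units, with label S. No edge of C(G) is
-- lighter than S, for otherwise K₁K₂ would be heavy. The heart of the proof: two maximal
-- cliques K, M that contain a set X with ∣X∣ ≥ ∣S∣ and are joined by a path of G − X lie in one
-- unit. If K ∩ M ⊋ X, then either K ∩ M separates K from M, and KM is a heavy edge, or we recurse
-- with X := K ∩ M. If K ∩ M = X, take an induced path w₀ … wₘ of G − X from K to M; every x ∈ X
-- sees w₀ and wₘ, hence w₁ by chordality, so X ∪ {w₀, w₁} extends to a maximal clique L, and
-- K, L and L, M are joined by shorter paths. Conversely a heavy edge has a label escaping S, so
-- the cliques of one unit are joined outside S. Consequently two maximal cliques containing S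
-- in different units meet exactly in S, are separated by it, and every edge of C(G) between
-- their units is labelled S; each of the four units contains such a clique.

module Submission where

open import Defs
open import Data.Bool using (true)
import Data.Bool.Properties as Bool
open import Data.Empty using (⊥-elim)
open import Data.Fin using (Fin; toℕ; zero; suc)
import Data.Fin.Properties as Fin
open import Data.Fin.Subset using (Subset; _∈_; _∉_; _⊆_; _∩_; _∪_; ⁅_⁆; ∣_∣)
open import Data.Fin.Subset.Properties
  using (_∈?_; x∈p∩q⁺; x∈p∩q⁻; p∩q⊆p; p∩q⊆q; p⊆p∪q; x∈p∪q⁺; x∈p∪q⁻; x∈⁅x⁆; x∈⁅y⁆⇒x≡y;
         ⊆-antisym; ∣p∣≤n; p⊆q⇒∣p∣≤∣q∣; p⊂q⇒∣p∣<∣q∣)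
open import Data.Nat using (ℕ; zero; suc; pred; _+_; _∸_; _≤_; _<_; z≤n; s≤s; _≤?_)
open import Data.Nat.Properties
open import Data.Product using (∃; ∃₂; _×_; _,_; proj₁; proj₂)
open import Data.Sum using (_⊎_; inj₁; inj₂; swap)
open import Data.Vec using (lookup; _∷_; [])
import Data.Vec.Properties as Vec
open import Function using (_∘_; id)
open import Function.Bundles using (_⇔_; mk⇔)
open import Relation.Binary.Definitions using (tri<; tri≈; tri>)
open import Relation.Binary.PropositionalEquality
  using (_≡_; _≢_; refl; trans; cong; subst; subst₂) renaming (sym to ≡-sym)
open import Relation.Nullary using (¬_; Dec; yes; no; contradiction)
open import Relation.Nullary.Decidable using (¬?; _×-dec_; _⊎-dec_; _→-dec_; map′; decidable-stable)

module _ {P : ℕ → Set} (P? : ∀ i → Dec (P i)) where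

  least : ∀ m → (∃ λ j → j ≤ m × P j) → ∃ λ i → i ≤ m × P i × (∀ {j} → j < i → ¬ P j)
  least m (j , j≤m , pj) with anyUpTo? P? m
  least zero    _ | yes (_ , () , _)
  least (suc m) _ | yes (j , s≤s j≤m , pj) =
    let i , i≤m , pi , below = least m (j , j≤m , pj) in i , m≤n⇒m≤1+n i≤m , pi , below
  least m (j , j≤m , pj) | no none = m , ≤-refl , pm , λ k<m pk → none (_ , k<m , pk)
    where
    pm : P m
    pm with m≤n⇒m<n∨m≡n j≤m
    ... | inj₁ j<m  = contradiction (j , j<m , pj) none
    ... | inj₂ refl = pj

extendAfter : ∀ {A : Set} → ℕ → (ℕ → A) → A → ℕ → A
extendAfter m f v i with i ≤? m
... | yes _ = f i
... | no  _ = v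

extendAfter-≤ : ∀ {A : Set} m f (v : A) {i} → i ≤ m → extendAfter m f v i ≡ f i
extendAfter-≤ m f v {i} i≤m with i ≤? m
... | yes _   = refl
... | no  i≰m = contradiction i≤m i≰m

extendAfter-suc : ∀ {A : Set} m f (v : A) → extendAfter m f v (suc m) ≡ v
extendAfter-suc m f v with suc m ≤? m
... | yes m<m = contradiction m<m (n≮n m)
... | no  _   = refl

<-+-exchange : ∀ {n f a b} → n < suc f + a → a < b → n < f + b
<-+-exchange {f = f} {a} {b} n<f+a a<b =
  <-≤-trans n<f+a (subst (_≤ f + b) (+-suc f a) (+-monoʳ-≤ f a<b))

0<⇒≡suc-pred : ∀ {m} → 0 < m → m ≡ suc (pred m)
0<⇒≡suc-pred {suc _} _ = refl

⊆-or-∉ : ∀ {n} (A B : Subset n) → A ⊆ B ⊎ ∃ λ z → z ∈ A × z ∉ B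
⊆-or-∉ A B with Fin.any? (λ z → z ∈? A ×-dec ¬? (z ∈? B))
... | yes witness = inj₂ witness
... | no  none    = inj₁ λ {z} z∈A → decidable-stable (z ∈? B) λ z∉B → none (z , z∈A , z∉B)

⊆∧∣∣≤⇒≡ : ∀ {n} {A B : Subset n} → A ⊆ B → ∣ B ∣ ≤ ∣ A ∣ → A ≡ B
⊆∧∣∣≤⇒≡ {A = A} {B} A⊆B ∣B∣≤∣A∣ with ⊆-or-∉ B A
... | inj₁ B⊆A            = ⊆-antisym A⊆B B⊆A
... | inj₂ (z , z∈B , z∉A) = contradiction ∣B∣≤∣A∣ (<⇒≱ (p⊂q⇒∣p∣<∣q∣ (A⊆B , z , z∈B , z∉A)))

CycConsec-sym : ∀ {k} {i j : Fin k} → CycConsec i j → CycConsec j i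
CycConsec-sym (inj₁ e)               = inj₂ (inj₁ e)
CycConsec-sym (inj₂ (inj₁ e))        = inj₁ e
CycConsec-sym (inj₂ (inj₂ (inj₁ e))) = inj₂ (inj₂ (inj₂ e))
CycConsec-sym (inj₂ (inj₂ (inj₂ e))) = inj₂ (inj₂ (inj₁ e))

module _ {n : ℕ} (G : Graph n) where

  adj? : ∀ u v → Dec (Adj G u v)
  adj? u v = adj G u v Bool.≟ true

  Adj-sym : ∀ {u v} → Adj G u v → Adj G v u
  Adj-sym {u} {v} = trans (Graph.sym G v u)

  Adj-irrefl : ∀ {u} → ¬ Adj G u u
  Adj-irrefl {u} u~u with trans (≡-sym u~u) (irrefl G u)
  ... | ()

  Reach-trans : ∀ {X u v w} → Reach G X u v → Reach G X v w → Reach G X u w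
  Reach-trans r (here _)        = r
  Reach-trans r (step r′ a w∉X) = step (Reach-trans r r′) a w∉X

  Clique⇒Reach : ∀ {X K x y} → Clique G K → x ∈ K → y ∈ K → x ∉ X → y ∉ X → Reach G X x y
  Clique⇒Reach {x = x} {y} cK x∈K y∈K x∉X y∉X with x Fin.≟ y
  ... | yes refl = here x∉X
  ... | no  x≢y  = step (here x∉X) (cK x y x∈K y∈K x≢y) y∉X

  Apart : Fin n → Fin n → Set
  Apart x y = x ≢ y × ¬ Adj G x y

  record InducedPath (X : Subset n) (u v : Fin n) : Set where
    field
      len       : ℕ
      vertex    : ℕ → Fin n
      start     : vertex 0 ≡ u
      end       : vertex len ≡ v
      avoids    : ∀ {i} → i ≤ len → vertex i ∉ X
      steps     : ∀ {i} → i < len → Adj G (vertex i) (vertex (suc i))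
      chordless : ∀ {a b} → 2 + a ≤ b → b ≤ len → Apart (vertex a) (vertex b)
  open InducedPath public

  singleton : ∀ {X u} → u ∉ X → InducedPath X u u
  singleton {u = u} u∉X = record
    { len = 0 ; vertex = λ _ → u ; start = refl ; end = refl
    ; avoids = λ _ → u∉X ; steps = λ ()
    ; chordless = λ 2+a≤b b≤0 → contradiction (≤-trans 2+a≤b b≤0) λ () }

  take : ∀ {X u v} (P : InducedPath X u v) {i} → i ≤ len P → InducedPath X u (vertex P i)
  take P {i} i≤len = record
    { len = i ; vertex = vertex P ; start = start P ; end = refl
    ; avoids    = λ j≤i → avoids P (≤-trans j≤i i≤len)
    ; steps     = λ j<i → steps P (<-≤-trans j<i i≤len)
    ; chordless = λ 2+a≤b b≤i → chordless P 2+a≤b (≤-trans b≤i i≤len) }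

  tail : ∀ {X u v} (P : InducedPath X u v) → 0 < len P → InducedPath X (vertex P 1) v
  tail {v = v} P 0<len = record
    { len = pred (len P) ; vertex = vertex P ∘ suc ; start = refl
    ; end       = subst (λ k → vertex P k ≡ v) len≡ (end P)
    ; avoids    = λ i≤ → avoids P (within (s≤s i≤))
    ; steps     = λ i< → steps P (within (s≤s i<))
    ; chordless = λ 2+a≤b b≤ → chordless P (s≤s 2+a≤b) (within (s≤s b≤)) }
    where
    len≡ : len P ≡ suc (pred (len P))
    len≡ = 0<⇒≡suc-pred 0<len
    within : ∀ {j} → j ≤ suc (pred (len P)) → j ≤ len P
    within = subst (_ ≤_) (≡-sym len≡)

  snoc : ∀ {X u w v} (P : InducedPath X u w) → Adj G w v → v ∉ X →
         (∀ {a} → a < len P → Apart (vertex P a) v) → InducedPath X u v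
  snoc {X} {w = w} {v} P w~v v∉X fresh = record
    { len = suc (len P) ; vertex = vertex′ ; start = trans (old z≤n) (start P) ; end = new
    ; avoids = avoids′ ; steps = steps′ ; chordless = chordless′ }
    where
    vertex′ = extendAfter (len P) (vertex P) v
    old : ∀ {i} → i ≤ len P → vertex′ i ≡ vertex P i
    old = extendAfter-≤ (len P) (vertex P) v
    new : vertex′ (suc (len P)) ≡ v
    new = extendAfter-suc (len P) (vertex P) v
    avoids′ : ∀ {i} → i ≤ suc (len P) → vertex′ i ∉ X
    avoids′ i≤ with m≤n⇒m<n∨m≡n i≤
    ... | inj₁ (s≤s i≤len) = subst (_∉ X) (≡-sym (old i≤len)) (avoids P i≤len)
    ... | inj₂ refl        = subst (_∉ X) (≡-sym new) v∉X
    steps′ : ∀ {i} → i < suc (len P) → Adj G (vertex′ i) (vertex′ (suc i))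
    steps′ (s≤s i≤len) with m≤n⇒m<n∨m≡n i≤len
    ... | inj₁ i<len = subst₂ (Adj G) (≡-sym (old (<⇒≤ i<len))) (≡-sym (old i<len)) (steps P i<len)
    ... | inj₂ refl  =
      subst₂ (Adj G) (≡-sym (trans (old ≤-refl) (end P))) (≡-sym new) w~v
    chordless′ : ∀ {a b} → 2 + a ≤ b → b ≤ suc (len P) → Apart (vertex′ a) (vertex′ b)
    chordless′ 2+a≤b b≤ with m≤n⇒m<n∨m≡n b≤
    ... | inj₁ (s≤s b≤len) =
      subst₂ Apart (≡-sym (old (≤-trans (m≤n+m _ 2) (≤-trans 2+a≤b b≤len)))) (≡-sym (old b≤len))
        (chordless P 2+a≤b b≤len)
    ... | inj₂ refl =
      subst₂ Apart (≡-sym (old (<⇒≤ (≤-pred 2+a≤b)))) (≡-sym new) (fresh (≤-pred 2+a≤b))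

  -- Cut the path at its first vertex that equals or sees v; the prefix stays chordless.
  InducedPath-step : ∀ {X u w v} → InducedPath X u w → Adj G w v → v ∉ X → InducedPath X u v
  InducedPath-step {X} {u} {v = v} P w~v v∉X
    with least (λ i → (vertex P i Fin.≟ v) ⊎-dec adj? (vertex P i) v) (len P)
               (len P , ≤-refl , inj₂ (subst (λ x → Adj G x v) (≡-sym (end P)) w~v))
  ... | i , i≤len , inj₁ i≡v , _      = subst (InducedPath X u) i≡v (take P i≤len)
  ... | i , i≤len , inj₂ i~v , before =
    snoc (take P i≤len) i~v v∉X λ a<i → before a<i ∘ inj₁ , before a<i ∘ inj₂

  Reach⇒InducedPath : ∀ {X u v} → Reach G X u v → InducedPath X u v
  Reach⇒InducedPath (here u∉X)       = singleton u∉X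
  Reach⇒InducedPath (step r w~v v∉X) = InducedPath-step (Reach⇒InducedPath r) w~v v∉X

  module _ {X u v} (P : InducedPath X u v) where

    InducedPath-start∉ : u ∉ X
    InducedPath-start∉ = subst (_∉ X) (start P) (avoids P z≤n)

    InducedPath-end∉ : v ∉ X
    InducedPath-end∉ = subst (_∉ X) (end P) (avoids P ≤-refl)

    InducedPath-successor : ∀ {a b} → a < b → b ≤ len P → Adj G (vertex P a) (vertex P b) → b ≡ suc a
    InducedPath-successor a<b b≤len a~b with m≤n⇒m<n∨m≡n a<b
    ... | inj₁ 2+a≤b  = contradiction a~b (proj₂ (chordless P 2+a≤b b≤len))
    ... | inj₂ 1+a≡b  = ≡-sym 1+a≡b

    InducedPath-adjacent : ∀ {a b} → a ≤ len P → b ≤ len P → Adj G (vertex P a) (vertex P b) →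
                           b ≡ suc a ⊎ a ≡ suc b
    InducedPath-adjacent {a} {b} a≤len b≤len a~b with <-cmp a b
    ... | tri< a<b _ _ = inj₁ (InducedPath-successor a<b b≤len a~b)
    ... | tri≈ _ refl _ = contradiction a~b Adj-irrefl
    ... | tri> _ _ b<a = inj₂ (InducedPath-successor b<a a≤len (Adj-sym a~b))

    InducedPath-distinct : ∀ {a b} → a < b → b ≤ len P → vertex P a ≢ vertex P b
    InducedPath-distinct {a} a<b b≤len eq with m≤n⇒m<n∨m≡n a<b
    ... | inj₁ 2+a≤b = proj₁ (chordless P 2+a≤b b≤len) eq
    ... | inj₂ refl  = Adj-irrefl (subst (λ x → Adj G x (vertex P (suc a))) eq (steps P b≤len))

    InducedPath-injective : ∀ {a b} → a ≤ len P → b ≤ len P → vertex P a ≡ vertex P b → a ≡ b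
    InducedPath-injective {a} {b} a≤len b≤len eq with <-cmp a b
    ... | tri< a<b _ _ = contradiction eq (InducedPath-distinct a<b b≤len)
    ... | tri≈ _ a≡b _ = a≡b
    ... | tri> _ _ b<a = contradiction (≡-sym eq) (InducedPath-distinct b<a a≤len)

    InducedPath-len< : len P < n
    InducedPath-len< with n ≤? len P
    ... | no  n≰len = ≰⇒> n≰len
    ... | yes n≤len with Fin.pigeonhole (s≤s n≤len) (vertex P ∘ toℕ)
    ...   | i , j , i<j , eq = contradiction eq (InducedPath-distinct i<j (≤-pred (Fin.toℕ<n j)))

  ReachWithin : Subset n → Fin n → ℕ → Fin n → Set
  ReachWithin X u zero    v = u ≡ v × u ∉ X
  ReachWithin X u (suc k) v =
    ReachWithin X u k v ⊎ ∃ λ w → ReachWithin X u k w × Adj G w v × v ∉ X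

  reachWithin? : ∀ X u k v → Dec (ReachWithin X u k v)
  reachWithin? X u zero    v = (u Fin.≟ v) ×-dec ¬? (u ∈? X)
  reachWithin? X u (suc k) v = reachWithin? X u k v ⊎-dec
    Fin.any? (λ w → reachWithin? X u k w ×-dec adj? w v ×-dec ¬? (v ∈? X))

  ReachWithin⇒Reach : ∀ {X u} k {v} → ReachWithin X u k v → Reach G X u v
  ReachWithin⇒Reach zero    (refl , u∉X)            = here u∉X
  ReachWithin⇒Reach (suc k) (inj₁ r)                = ReachWithin⇒Reach k r
  ReachWithin⇒Reach (suc k) (inj₂ (_ , r , w~v , v∉X)) = step (ReachWithin⇒Reach k r) w~v v∉X

  ReachWithin-weaken : ∀ {X u v} j {k} → ReachWithin X u k v → ReachWithin X u (j + k) v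
  ReachWithin-weaken zero    r = r
  ReachWithin-weaken (suc j) r = inj₁ (ReachWithin-weaken j r)

  InducedPath⇒ReachWithin : ∀ {X u v} (P : InducedPath X u v) {i} → i ≤ len P →
                            ReachWithin X u i (vertex P i)
  InducedPath⇒ReachWithin {X} P {zero}  _ = ≡-sym (start P) , subst (_∉ X) (start P) (avoids P z≤n)
  InducedPath⇒ReachWithin     P {suc i} i<len =
    inj₂ (vertex P i , InducedPath⇒ReachWithin P (<⇒≤ i<len) , steps P i<len , avoids P i<len)

  -- Every walk shortens to an induced path, which has fewer than n edges.
  Reach? : ∀ X u v → Dec (Reach G X u v)
  Reach? X u v = map′ (ReachWithin⇒Reach n) Reach⇒ReachWithin (reachWithin? X u n v)
    where
    Reach⇒ReachWithin : Reach G X u v → ReachWithin X u n v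
    Reach⇒ReachWithin r =
      subst₂ (ReachWithin X u) (m∸n+n≡m (<⇒≤ (InducedPath-len< P))) (end P)
        (ReachWithin-weaken (n ∸ len P) (InducedPath⇒ReachWithin P ≤-refl))
      where P = Reach⇒InducedPath r

  cone : ∀ {X u v} → Fin n → (P : InducedPath X u v) → Fin (2 + len P) → Fin n
  cone s P zero    = s
  cone s P (suc i) = vertex P (toℕ i)

  module _ {X u v s} (P : InducedPath X u v) (s∉P : ∀ {i} → i ≤ len P → s ≢ vertex P i)
           (s~u : Adj G s u) (s~v : Adj G s v)
           (s≁inner : ∀ {i} → 1 ≤ i → i < len P → ¬ Adj G s (vertex P i)) where

    private
      bound : (i : Fin (suc (len P))) → toℕ i ≤ len P
      bound i = ≤-pred (Fin.toℕ<n i)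

      successor-adjacent : ∀ {a b} → b ≡ suc a → b ≤ len P → Adj G (vertex P a) (vertex P b)
      successor-adjacent refl = steps P

      apex⇒consecutive : ∀ j → Adj G s (vertex P (toℕ j)) → CycConsec {2 + len P} zero (suc j)
      apex⇒consecutive j s~j with toℕ j ≟ 0 | toℕ j ≟ len P
      ... | yes j≡0 | _         = inj₁ (cong suc j≡0)
      ... | no  _   | yes j≡len = inj₂ (inj₂ (inj₁ (refl , cong (2 +_) j≡len)))
      ... | no  j≢0 | no  j≢len =
        contradiction s~j (s≁inner (n≢0⇒n>0 j≢0) (≤∧≢⇒< (bound j) j≢len))

      consecutive⇒apex : ∀ j → CycConsec {2 + len P} zero (suc j) → Adj G s (vertex P (toℕ j))
      consecutive⇒apex j (inj₁ 1+j≡1) =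
        subst (λ i → Adj G s (vertex P i)) (≡-sym (suc-injective 1+j≡1))
          (subst (Adj G s) (≡-sym (start P)) s~u)
      consecutive⇒apex j (inj₂ (inj₂ (inj₁ (_ , 2+j≡2+len)))) =
        subst (λ i → Adj G s (vertex P i)) (≡-sym (suc-injective (suc-injective 2+j≡2+len)))
          (subst (Adj G s) (≡-sym (end P)) s~v)
      consecutive⇒apex j (inj₂ (inj₁ ()))
      consecutive⇒apex j (inj₂ (inj₂ (inj₂ (() , _))))

      path⇔consecutive : ∀ i j → Adj G (vertex P (toℕ i)) (vertex P (toℕ j)) ⇔
                                  CycConsec {2 + len P} (suc i) (suc j)
      path⇔consecutive i j = mk⇔ to from
        where
        to : Adj G (vertex P (toℕ i)) (vertex P (toℕ j)) → CycConsec {2 + len P} (suc i) (suc j)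
        to i~j with InducedPath-adjacent P (bound i) (bound j) i~j
        ... | inj₁ j≡1+i = inj₁ (cong suc j≡1+i)
        ... | inj₂ i≡1+j = inj₂ (inj₁ (cong suc i≡1+j))
        from : CycConsec {2 + len P} (suc i) (suc j) → Adj G (vertex P (toℕ i)) (vertex P (toℕ j))
        from (inj₁ e)                     = successor-adjacent (suc-injective e) (bound j)
        from (inj₂ (inj₁ e))              = Adj-sym (successor-adjacent (suc-injective e) (bound i))
        from (inj₂ (inj₂ (inj₁ (() , _))))
        from (inj₂ (inj₂ (inj₂ (() , _))))

    cone-injective : ∀ i j → cone s P i ≡ cone s P j → i ≡ j
    cone-injective zero    zero    _  = refl
    cone-injective zero    (suc j) eq = contradiction eq (s∉P (bound j))
    cone-injective (suc i) zero    eq = contradiction (≡-sym eq) (s∉P (bound i))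
    cone-injective (suc i) (suc j) eq =
      cong suc (Fin.toℕ-injective (InducedPath-injective P (bound i) (bound j) eq))

    cone-adjacent⇔ : ∀ i j → Adj G (cone s P i) (cone s P j) ⇔ CycConsec i j
    cone-adjacent⇔ zero    zero    = mk⇔ (λ s~s → contradiction s~s Adj-irrefl) λ
      { (inj₁ ()) ; (inj₂ (inj₁ ())) ; (inj₂ (inj₂ (inj₁ (_ , ())))) ; (inj₂ (inj₂ (inj₂ (_ , ())))) }
    cone-adjacent⇔ zero    (suc j) = mk⇔ (apex⇒consecutive j) (consecutive⇒apex j)
    cone-adjacent⇔ (suc i) zero    =
      mk⇔ (CycConsec-sym ∘ apex⇒consecutive i ∘ Adj-sym) (Adj-sym ∘ consecutive⇒apex i ∘ CycConsec-sym)
    cone-adjacent⇔ (suc i) (suc j) = path⇔consecutive i j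

    cone-induced : InducedCycle G (2 + len P) (cone s P)
    cone-induced = cone-injective , cone-adjacent⇔

  -- Take the first inner vertex seen by s: unless it is the second one, it closes an
  -- induced cycle with s of length at least four.
  chordal-fan : Chordal G → ∀ {X u v s} (P : InducedPath X u v) → 0 < len P →
                (∀ {i} → i ≤ len P → s ≢ vertex P i) → Adj G s u → Adj G s v → Adj G s (vertex P 1)
  chordal-fan chordal {s = s} P 0<len s∉P s~u s~v
    with least (λ i → 1 ≤? i ×-dec adj? s (vertex P i)) (len P)
               (len P , ≤-refl , 0<len , subst (Adj G s) (≡-sym (end P)) s~v)
  ... | i , i≤len , (1≤i , s~i) , s≁before with i ≟ 1
  ...   | yes refl = s~i
  ...   | no  i≢1  = contradiction
    (cone-induced (take P i≤len) (λ j≤i → s∉P (≤-trans j≤i i≤len)) s~u s~i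
                  (λ 1≤j j<i s~j → s≁before j<i (1≤j , s~j)))
    (chordal (2 + i) (s≤s (s≤s (≤∧≢⇒< 1≤i (i≢1 ∘ ≡-sym)))) (cone s (take P i≤len)))

  Clique-insert : ∀ {C v} → Clique G C → (∀ {x} → x ∈ C → x ≢ v → Adj G x v) → Clique G (C ∪ ⁅ v ⁆)
  Clique-insert {C} {v} cC C~v x y x∈ y∈ x≢y with x∈p∪q⁻ C ⁅ v ⁆ x∈ | x∈p∪q⁻ C ⁅ v ⁆ y∈
  ... | inj₁ x∈C | inj₁ y∈C = cC x y x∈C y∈C x≢y
  ... | inj₁ x∈C | inj₂ y∈v with x∈⁅y⁆⇒x≡y v y∈v
  ...   | refl = C~v x∈C x≢y
  Clique-insert {C} {v} cC C~v x y x∈ y∈ x≢y | inj₂ x∈v | inj₁ y∈C with x∈⁅y⁆⇒x≡y v x∈v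
  ...   | refl = Adj-sym (C~v y∈C (x≢y ∘ ≡-sym))
  Clique-insert {C} {v} cC C~v x y x∈ y∈ x≢y | inj₂ x∈v | inj₂ y∈v =
    contradiction (trans (x∈⁅y⁆⇒x≡y v x∈v) (≡-sym (x∈⁅y⁆⇒x≡y v y∈v))) x≢y

  extendToMaximalClique : ∀ {C} → Clique G C → ∃ λ L → MaximalClique G L × C ⊆ L
  extendToMaximalClique {C} cC = grow (suc n) cC (s≤s (m≤m+n n ∣ C ∣))
    where
    grow : ∀ fuel {C} → Clique G C → n < fuel + ∣ C ∣ → ∃ λ L → MaximalClique G L × C ⊆ L
    grow zero {C} _ n<∣C∣ = contradiction (∣p∣≤n C) (<⇒≱ n<∣C∣)
    grow (suc fuel) {C} cC n<
      with Fin.any? (λ x → ¬? (x ∈? C) ×-dec Fin.all? (λ y → y ∈? C →-dec adj? y x))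
    ... | yes (x , x∉C , C~x) =
      let L , mL , C∪x⊆L = grow fuel (Clique-insert cC λ y∈C _ → C~x _ y∈C) (<-+-exchange n< ∣C∣<)
      in L , mL , C∪x⊆L ∘ p⊆p∪q ⁅ x ⁆
      where
      ∣C∣< : ∣ C ∣ < ∣ C ∪ ⁅ x ⁆ ∣
      ∣C∣< = p⊂q⇒∣p∣<∣q∣ (p⊆p∪q ⁅ x ⁆ , x , x∈p∪q⁺ (inj₂ (x∈⁅x⁆ x)) , x∉C)
    ... | no none = C , (cC , maximal) , id
      where
      maximal : ∀ K → Clique G K → C ⊆ K → K ≡ C
      maximal K cK C⊆K with ⊆-or-∉ K C
      ... | inj₁ K⊆C             = ⊆-antisym K⊆C C⊆K
      ... | inj₂ (z , z∈K , z∉C) = ⊥-elim (none (z , z∉C , λ y y∈C →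
              cK y z (C⊆K y∈C) z∈K λ y≡z → z∉C (subst (_∈ C) y≡z y∈C)))

  MaximalClique-⊈ : ∀ {K M} → MaximalClique G K → MaximalClique G M → K ≢ M → ∃ λ u → u ∈ K × u ∉ M
  MaximalClique-⊈ {K} {M} (_ , maxK) (cM , _) K≢M with ⊆-or-∉ K M
  ... | inj₁ K⊆M    = contradiction (≡-sym (maxK M cM K⊆M)) K≢M
  ... | inj₂ witness = witness

  separated⇒CEdge : ∀ {K M u v} → MaximalClique G K → MaximalClique G M → K ≢ M →
                    u ∈ K → u ∉ M → v ∈ M → v ∉ K → ¬ Reach G (K ∩ M) u v → CEdge G K M
  separated⇒CEdge {K} {M} {u} {v} mK@(cK , _) mM@(cM , _) K≢M u∈K u∉M v∈M v∉K u↛v =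
    mK , mM , K≢M , λ u′ v′ u′∈K u′∉M v′∈M v′∉K →
      (∉M u′∉M , ∉K v′∉K , λ u′→v′ → u↛v
        (Reach-trans (Clique⇒Reach cK u∈K u′∈K (∉M u∉M) (∉M u′∉M))
          (Reach-trans u′→v′ (Clique⇒Reach cM v′∈M v∈M (∉K v′∉K) (∉K v∉K))))) ,
      λ { Y (_ , t , t∈K∩M , t∉Y) (u′∉Y , v′∉Y , u′↛v′) → u′↛v′
            (Reach-trans (Clique⇒Reach cK u′∈K (p∩q⊆p K M t∈K∩M) u′∉Y t∉Y)
                         (Clique⇒Reach cM (p∩q⊆q K M t∈K∩M) v′∈M t∉Y v′∉Y)) }
    where
    ∉M : ∀ {x} → x ∉ M → x ∉ K ∩ M
    ∉M x∉M = x∉M ∘ p∩q⊆q K M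
    ∉K : ∀ {x} → x ∉ K → x ∉ K ∩ M
    ∉K x∉K = x∉K ∘ p∩q⊆p K M

  SameUnit-trans : ∀ {K L M} → SameUnit G K L → SameUnit G L M → SameUnit G K M
  SameUnit-trans r (here _)     = r
  SameUnit-trans r (step r′ e) = step (SameUnit-trans r r′) e

  SameUnit-sym : ∀ {K M} → SameUnit G K M → SameUnit G M K
  SameUnit-sym (here mK)  = here mK
  SameUnit-sym (step r e) = SameUnit-trans (step (here (maximal e)) (swap e)) (SameUnit-sym r)
    where
    maximal : ∀ {L M} → HeavyEdge G L M ⊎ HeavyEdge G M L → MaximalClique G M
    maximal (inj₁ ((_ , mM , _) , _)) = mM
    maximal (inj₂ ((mM , _) , _))     = mM

  SameUnit-maximalˡ : ∀ {K M} → SameUnit G K M → MaximalClique G K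
  SameUnit-maximalˡ (here mK)  = mK
  SameUnit-maximalˡ (step r _) = SameUnit-maximalˡ r

  SameUnit-maximalʳ : ∀ {K M} → SameUnit G K M → MaximalClique G M
  SameUnit-maximalʳ = SameUnit-maximalˡ ∘ SameUnit-sym

  heavy-or-linked : ∀ {L₀ L₀′ K M} → CEdge G L₀ L₀′ → MaximalClique G K → MaximalClique G M → K ≢ M →
                    ∣ L₀ ∩ L₀′ ∣ < ∣ K ∩ M ∣ →
                    HeavyEdge G K M ⊎ ∃₂ λ u v → u ∈ K × v ∈ M × Reach G (K ∩ M) u v
  heavy-or-linked {L₀} {L₀′} {K} {M} e₀ mK mM K≢M lighter
    with MaximalClique-⊈ mK mM K≢M | MaximalClique-⊈ mM mK (K≢M ∘ ≡-sym)
  ... | u , u∈K , u∉M | v , v∈M , v∉K with Reach? (K ∩ M) u v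
  ...   | yes u→v = inj₂ (u , v , u∈K , v∈M , u→v)
  ...   | no  u↛v = inj₁ (separated⇒CEdge mK mM K≢M u∈K u∉M v∈M v∉K u↛v , L₀ , L₀′ , e₀ , lighter)

  fan-clique : Chordal G → ∀ {X K M u v} → MaximalClique G K → MaximalClique G M → X ⊆ K → X ⊆ M →
               u ∈ K → v ∈ M → (P : InducedPath X u v) → 0 < len P →
               Clique G ((X ∪ ⁅ u ⁆) ∪ ⁅ vertex P 1 ⁆)
  fan-clique chordal {X} {u = u} (cK , _) (cM , _) X⊆K X⊆M u∈K v∈M P 0<len =
    Clique-insert (Clique-insert cX X~u) X∪u~w₁
    where
    ∈X⇒∉P : ∀ {x} → x ∈ X → ∀ {i} → i ≤ len P → x ≢ vertex P i
    ∈X⇒∉P x∈X i≤len x≡ = avoids P i≤len (subst (_∈ X) x≡ x∈X)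
    cX : Clique G X
    cX x y x∈X y∈X = cK x y (X⊆K x∈X) (X⊆K y∈X)
    X~u : ∀ {x} → x ∈ X → x ≢ u → Adj G x u
    X~u x∈X = cK _ u (X⊆K x∈X) u∈K
    X~v : ∀ {x} → x ∈ X → Adj G x _
    X~v x∈X = cM _ _ (X⊆M x∈X) v∈M λ { refl → InducedPath-end∉ P x∈X }
    X∪u~w₁ : ∀ {x} → x ∈ X ∪ ⁅ u ⁆ → x ≢ vertex P 1 → Adj G x (vertex P 1)
    X∪u~w₁ {x} x∈ _ with x∈p∪q⁻ X ⁅ u ⁆ x∈
    ... | inj₁ x∈X = chordal-fan chordal P 0<len (∈X⇒∉P x∈X)
                       (X~u x∈X λ { refl → InducedPath-start∉ P x∈X }) (X~v x∈X)
    ... | inj₂ x∈u with x∈⁅y⁆⇒x≡y u x∈u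
    ...   | refl = subst (λ y → Adj G y (vertex P 1)) (start P) (steps P 0<len)

  fan-maximalClique : Chordal G → ∀ {X K M u v} → MaximalClique G K → MaximalClique G M →
                      X ⊆ K → X ⊆ M → u ∈ K → v ∈ M → (P : InducedPath X u v) → 0 < len P →
                      ∃ λ L → MaximalClique G L × X ⊆ L × u ∈ L × vertex P 1 ∈ L
  fan-maximalClique chordal {u = u} mK mM X⊆K X⊆M u∈K v∈M P 0<len
    with extendToMaximalClique (fan-clique chordal mK mM X⊆K X⊆M u∈K v∈M P 0<len)
  ... | L , mL , C⊆L = L , mL , C⊆L ∘ p⊆p∪q _ ∘ p⊆p∪q _ ,
                       C⊆L (p⊆p∪q _ (x∈p∪q⁺ (inj₂ (x∈⁅x⁆ u)))) , C⊆L (x∈p∪q⁺ (inj₂ (x∈⁅x⁆ _)))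

  InducedPath-nontrivial : ∀ {X K M u v} → K ∩ M ⊆ X → u ∈ K → v ∈ M → (P : InducedPath X u v) → 0 < len P
  InducedPath-nontrivial {M = M} K∩M⊆X u∈K v∈M P = n≢0⇒n>0 λ len≡0 →
    InducedPath-start∉ P (K∩M⊆X (x∈p∩q⁺ (u∈K ,
      subst (_∈ M) (trans (≡-sym (end P)) (trans (cong (vertex P) len≡0) (start P))) v∈M)))

  module _ (chordal : Chordal G) {L₀ L₀′} (e₀ : CEdge G L₀ L₀′) where

    -- Lexicographic induction: fuel bounds n ∸ ∣ X ∣ and D the length of the path.
    sameUnit-by-path : ∀ fuel D {X K M u v} → n < fuel + ∣ X ∣ → ∣ L₀ ∩ L₀′ ∣ ≤ ∣ X ∣ →
      MaximalClique G K → MaximalClique G M → X ⊆ K → X ⊆ M → u ∈ K → v ∈ M →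
      (P : InducedPath X u v) → len P < D → SameUnit G K M
    sameUnit-by-path _ zero _ _ _ _ _ _ _ _ _ ()
    sameUnit-by-path fuel (suc D) {X} {K} {M} n< w≤ mK mM X⊆K X⊆M u∈K v∈M P len<D
      with ⊆-or-∉ (K ∩ M) X
    sameUnit-by-path zero (suc D) {X} n< _ _ _ _ _ _ _ _ _ | inj₂ _ =
      contradiction (∣p∣≤n X) (<⇒≱ n<)
    sameUnit-by-path (suc fuel) (suc D) {X} {K} {M} n< w≤ mK mM X⊆K X⊆M _ _ _ _
      | inj₂ (t , t∈K∩M , t∉X)
      with p⊂q⇒∣p∣<∣q∣ ((λ x∈X → x∈p∩q⁺ (X⊆K x∈X , X⊆M x∈X)) , t , t∈K∩M , t∉X)
         | Vec.≡-dec Bool._≟_ K M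
    ... | _     | yes refl = here mK
    ... | X<K∩M | no  K≢M with heavy-or-linked e₀ mK mM K≢M (≤-<-trans w≤ X<K∩M)
    ...   | inj₁ heavy = step (here mK) (inj₁ heavy)
    ...   | inj₂ (_ , _ , u′∈K , v′∈M , u′→v′) =
      sameUnit-by-path fuel (suc (len Q)) (<-+-exchange n< X<K∩M) (≤-trans w≤ (<⇒≤ X<K∩M))
        mK mM (p∩q⊆p K M) (p∩q⊆q K M) u′∈K v′∈M Q ≤-refl
      where Q = Reach⇒InducedPath u′→v′
    sameUnit-by-path fuel (suc D) n< w≤ mK mM X⊆K X⊆M u∈K v∈M P len<D | inj₁ K∩M⊆X
      with InducedPath-nontrivial K∩M⊆X u∈K v∈M P
    ... | 0<len with fan-maximalClique chordal mK mM X⊆K X⊆M u∈K v∈M P 0<len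
    ...   | L , mL , X⊆L , u∈L , w₁∈L =
      SameUnit-trans
        (sameUnit-by-path fuel D n< w≤ mK mL X⊆K X⊆L u∈K u∈L (singleton (InducedPath-start∉ P))
          (<-≤-trans 0<len (≤-pred len<D)))
        (sameUnit-by-path fuel D n< w≤ mL mM X⊆L X⊆M w₁∈L v∈M (tail P 0<len)
          (subst (_≤ D) (0<⇒≡suc-pred 0<len) (≤-pred len<D)))

    sameUnit-by-reach : ∀ {X K M u v} → ∣ L₀ ∩ L₀′ ∣ ≤ ∣ X ∣ → MaximalClique G K → MaximalClique G M →
                        X ⊆ K → X ⊆ M → u ∈ K → v ∈ M → Reach G X u v → SameUnit G K M
    sameUnit-by-reach {X} w≤ mK mM X⊆K X⊆M u∈K v∈M u→v =
      sameUnit-by-path (suc n) (suc (len P)) (s≤s (m≤m+n n ∣ X ∣)) w≤ mK mM X⊆K X⊆M u∈K v∈M P ≤-refl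
      where P = Reach⇒InducedPath u→v

  crossing-edge-minimum : ∀ {U U′ K M} → SameUnit G U K → SameUnit G U′ M → CEdge G K M →
                          ¬ SameUnit G U U′ → ∀ {L L′} → CEdge G L L′ → ∣ K ∩ M ∣ ≤ ∣ L ∩ L′ ∣
  crossing-edge-minimum {K = K} {M} U~K U′~M eKM U≁U′ {L} {L′} eLL′ with ∣ K ∩ M ∣ ≤? ∣ L ∩ L′ ∣
  ... | yes lighter   = lighter
  ... | no  ¬lighter = contradiction
    (SameUnit-trans (step U~K (inj₁ (eKM , L , L′ , eLL′ , ≰⇒> ¬lighter))) (SameUnit-sym U′~M)) U≁U′

  module MinimumEdge (chordal : Chordal G) {K₁ K₂} (e₁₂ : CEdge G K₁ K₂)
                     (minimum : ∀ {L L′} → CEdge G L L′ → ∣ K₁ ∩ K₂ ∣ ≤ ∣ L ∩ L′ ∣) where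

    S : Subset n
    S = K₁ ∩ K₂

    LinkedOutside : Subset n → Subset n → Set
    LinkedOutside K M = ∀ {x y} → x ∈ K → x ∉ S → y ∈ M → y ∉ S → Reach G S x y

    HeavyEdge-⊈S : ∀ {L M} → HeavyEdge G L M → ∃ λ z → z ∈ L ∩ M × z ∉ S
    HeavyEdge-⊈S {L} {M} (_ , L₀ , L₀′ , e₀ , lighter) with ⊆-or-∉ (L ∩ M) S
    ... | inj₁ L∩M⊆S = contradiction (minimum e₀) (<⇒≱ (<-≤-trans lighter (p⊆q⇒∣p∣≤∣q∣ L∩M⊆S)))
    ... | inj₂ witness = witness

    MaximalClique-⊈S : ∀ {K} → MaximalClique G K → ∃ λ x → x ∈ K × x ∉ S
    MaximalClique-⊈S {K} (cK , maxK) with ⊆-or-∉ K S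
    ... | inj₂ witness = witness
    ... | inj₁ K⊆S     = contradiction (trans (maxK K₁ c₁ (p∩q⊆p K₁ K₂ ∘ K⊆S))
                                             (≡-sym (maxK K₂ c₂ (p∩q⊆q K₁ K₂ ∘ K⊆S)))) K₁≢K₂
      where
      c₁ = proj₁ (proj₁ e₁₂)
      c₂ = proj₁ (proj₁ (proj₂ e₁₂))
      K₁≢K₂ = proj₁ (proj₂ (proj₂ e₁₂))

    HeavyLink-⊈S : ∀ {L M} → HeavyEdge G L M ⊎ HeavyEdge G M L → ∃ λ z → z ∈ L × z ∈ M × z ∉ S
    HeavyLink-⊈S {L} {M} (inj₁ heavy) with HeavyEdge-⊈S heavy
    ... | z , z∈L∩M , z∉S = z , proj₁ (x∈p∩q⁻ L M z∈L∩M) , proj₂ (x∈p∩q⁻ L M z∈L∩M) , z∉S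
    HeavyLink-⊈S {L} {M} (inj₂ heavy) with HeavyEdge-⊈S heavy
    ... | z , z∈M∩L , z∉S = z , proj₂ (x∈p∩q⁻ M L z∈M∩L) , proj₁ (x∈p∩q⁻ M L z∈M∩L) , z∉S

    SameUnit⇒LinkedOutside : ∀ {K M} → SameUnit G K M → LinkedOutside K M
    SameUnit⇒LinkedOutside (here (cK , _)) x∈K x∉S y∈K y∉S = Clique⇒Reach cK x∈K y∈K x∉S y∉S
    SameUnit⇒LinkedOutside (step K~L e) x∈K x∉S y∈M y∉S with HeavyLink-⊈S e
    ... | z , z∈L , z∈M , z∉S =
      Reach-trans (SameUnit⇒LinkedOutside K~L x∈K x∉S z∈L z∉S)
                  (Clique⇒Reach (proj₁ (SameUnit-maximalʳ (step K~L e))) z∈M y∈M z∉S y∉S)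

    LinkedOutside⇒SameUnit : ∀ {K M} → MaximalClique G K → MaximalClique G M → S ⊆ K → S ⊆ M →
                             LinkedOutside K M → SameUnit G K M
    LinkedOutside⇒SameUnit mK mM S⊆K S⊆M linked with MaximalClique-⊈S mK | MaximalClique-⊈S mM
    ... | x , x∈K , x∉S | y , y∈M , y∉S =
      sameUnit-by-reach chordal e₁₂ ≤-refl mK mM S⊆K S⊆M x∈K y∈M (linked x∈K x∉S y∈M y∉S)

    module _ {K M} (mK : MaximalClique G K) (mM : MaximalClique G M) (S⊆K : S ⊆ K) (S⊆M : S ⊆ M)
             (K≁M : ¬ SameUnit G K M) where

      private
        unlinked : ¬ LinkedOutside K M
        unlinked = K≁M ∘ LinkedOutside⇒SameUnit mK mM S⊆K S⊆M

      crossing-label⊆S : ∀ {K′ M′} → SameUnit G K K′ → SameUnit G M M′ → K′ ∩ M′ ⊆ S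
      crossing-label⊆S {K′} {M′} K~K′ M~M′ {z} z∈ = decidable-stable (z ∈? S) λ z∉S →
        unlinked λ x∈K x∉S y∈M y∉S → Reach-trans
          (SameUnit⇒LinkedOutside K~K′ x∈K x∉S (p∩q⊆p K′ M′ z∈) z∉S)
          (SameUnit⇒LinkedOutside (SameUnit-sym M~M′) (p∩q⊆q K′ M′ z∈) z∉S y∈M y∉S)

      apart-∩≡S : K ∩ M ≡ S
      apart-∩≡S = ⊆-antisym (crossing-label⊆S (here mK) (here mM)) (λ s∈S → x∈p∩q⁺ (S⊆K s∈S , S⊆M s∈S))

      apart-CEdge : CEdge G K M
      apart-CEdge with Vec.≡-dec Bool._≟_ K M
      ... | yes refl = contradiction (here mK) K≁M
      ... | no  K≢M with MaximalClique-⊈ mK mM K≢M | MaximalClique-⊈ mM mK (K≢M ∘ ≡-sym)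
      ...   | u , u∈K , u∉M | v , v∈M , v∉K =
        separated⇒CEdge mK mM K≢M u∈K u∉M v∈M v∉K λ u→v → unlinked λ x∈K x∉S y∈M y∉S →
          Reach-trans (Clique⇒Reach (proj₁ mK) x∈K u∈K x∉S (u∉M ∘ S⊆M))
            (Reach-trans (subst (λ T → Reach G T u v) apart-∩≡S u→v)
                         (Clique⇒Reach (proj₁ mM) v∈M y∈M (v∉K ∘ S⊆K) y∉S))

      crossing-label≡S : ∀ {K′ M′} → SameUnit G K K′ → SameUnit G M M′ → CEdge G K′ M′ → K′ ∩ M′ ≡ S
      crossing-label≡S K~K′ M~M′ e = ⊆∧∣∣≤⇒≡ (crossing-label⊆S K~K′ M~M′) (minimum e)

    layerEdge-labelled-S : ∀ {U U′ K M} → SameUnit G U K → SameUnit G U′ M → S ⊆ K → S ⊆ M →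
      ¬ SameUnit G U U′ →
      LayerAdj G U U′ × LayerEdgeLabel G U U′ S × (∀ K′ M′ → Crossing G U U′ K′ M′ → K′ ∩ M′ ≡ S)
    layerEdge-labelled-S {K = K} {M} U~K U′~M S⊆K S⊆M U≁U′ =
      (U≁U′ , K , M , crossing) , (U≁U′ , K , M , crossing , apart-∩≡S mK mM S⊆K S⊆M K≁M) ,
      λ { K′ M′ (e , U~K′ , U′~M′) → crossing-label≡S mK mM S⊆K S⊆M K≁M
            (SameUnit-trans (SameUnit-sym U~K) U~K′) (SameUnit-trans (SameUnit-sym U′~M) U′~M′) e }
      where
      mK = SameUnit-maximalʳ U~K
      mM = SameUnit-maximalʳ U′~M
      K≁M : ¬ SameUnit G K M
      K≁M K~M = U≁U′ (SameUnit-trans U~K (SameUnit-trans K~M (SameUnit-sym U′~M)))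
      crossing : Crossing G _ _ K M
      crossing = apart-CEdge mK mM S⊆K S⊆M K≁M , U~K , U′~M

mainTheorem5 : ∀ {n} (G : Graph n) → Connected G → Chordal G →
    (K⋆ : Subset n) → LayerStructureRoot G K⋆ →
    (U₁ U₂ U₃ U₄ S : Subset n) →
    MaximalClique G U₁ → MaximalClique G U₂ → MaximalClique G U₃ → MaximalClique G U₄ →
    LayerEdgeLabel G U₁ U₂ S → LayerEdgeLabel G U₃ U₄ S →
    ¬ (SameUnit G U₁ U₃ × SameUnit G U₂ U₄) →
    ¬ (SameUnit G U₁ U₄ × SameUnit G U₂ U₃) →
    ∀ (i j : Fin 4) →
      let Ui = lookup (U₁ ∷ U₂ ∷ U₃ ∷ U₄ ∷ []) i
          Uj = lookup (U₁ ∷ U₂ ∷ U₃ ∷ U₄ ∷ []) j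
      in ¬ SameUnit G Ui Uj →
         LayerAdj G Ui Uj × LayerEdgeLabel G Ui Uj S
           × (∀ K K' → Crossing G Ui Uj K K' → K ∩ K' ≡ S)
mainTheorem5 G _ chordal _ _ U₁ U₂ U₃ U₄ .(K₁ ∩ K₂) _ _ _ _
  (U₁≁U₂ , K₁ , K₂ , (e₁₂ , U₁~K₁ , U₂~K₂) , refl) (_ , K₃ , K₄ , (_ , U₃~K₃ , U₄~K₄) , K₃∩K₄≡S) _ _ i j =
  let _ , Uᵢ~Kᵢ , S⊆Kᵢ = through i
      _ , Uⱼ~Kⱼ , S⊆Kⱼ = through j
  in layerEdge-labelled-S Uᵢ~Kᵢ Uⱼ~Kⱼ S⊆Kᵢ S⊆Kⱼ
  where
  open MinimumEdge G chordal e₁₂ (crossing-edge-minimum G U₁~K₁ U₂~K₂ e₁₂ U₁≁U₂)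
  through : (k : Fin 4) → ∃ λ K → SameUnit G (lookup (U₁ ∷ U₂ ∷ U₃ ∷ U₄ ∷ []) k) K × S ⊆ K
  through zero                   = K₁ , U₁~K₁ , p∩q⊆p K₁ K₂
  through (suc zero)             = K₂ , U₂~K₂ , p∩q⊆q K₁ K₂
  through (suc (suc zero))       = K₃ , U₃~K₃ , p∩q⊆p K₃ K₄ ∘ subst (_ ∈_) (≡-sym K₃∩K₄≡S)
  through (suc (suc (suc zero))) = K₄ , U₄~K₄ , p∩q⊆q K₃ K₄ ∘ subst (_ ∈_) (≡-sym K₃∩K₄≡S)
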